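{- Let $\Pi$ be an affine plane of order $q$ and let $S=\mathcal{P}_S\cup\mathcal{L}_S$ be a set of vertices of its incidence graph, where $\mathcal{P}_S$ is a set of points and $\mathcal{L}_S$ a set of lines. Then $S$ is a resolving set for $\Pi$ if and only if the following hold. (A1) There is at most one uncovered outer point. (A2) On every inner line, there is at most one $1$-covered outer point. (A1') For each covered direction $d$, there is at most one outer skew line with direction $d$; and there is at most one outer skew line having an uncovered direction. (A2') For each inner point, there is at most one tangent line through it having uncovered direction.
   Context: A resolving set is a vertex set $S$ of the incidence graph (bipartite graph on points and lines, adjacency = incidence) such that every two distinct vertices $u\neq v$ have some $x\in S$ with $d(u,x)\neq d(v,x)$. Elements of $S$ are called inner, others outer. A point is $t$-covered if it lies on exactly $t$ lines of $\mathcal{L}_S$, and uncovered if it is $0$-covered. A line is skew (resp. tangent) if it contains no point (resp. exactly one point) of $\mathcal{P}_S$. A direction is a parallel class of lines; the direction of a line is its parallel class; a direction is covered if $\mathcal{L}_S$ contains a line with that direction, and uncovered otherwise. -}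

module Defs where

open import Data.Nat using (ℕ; zero; suc)
open import Data.Fin using (Fin)
open import Data.Fin.Subset using (Subset; _∈_; _∉_)
open import Data.List using (List; length; filter)
open import Data.List using () renaming (allFin to allFinL)
open import Data.Sum using (_⊎_; inj₁; inj₂)
open import Data.Product using (Σ; ∃; ∃-syntax; _×_; _,_)
open import Data.Empty using (⊥)
open import Relation.Nullary using (¬_; Dec)
open import Relation.Binary.PropositionalEquality using (_≡_; _≢_)

record AffinePlane (q : ℕ) : Set₁ where
  field
    nP nL : ℕ
    _I_ : Fin nP → Fin nL → Set
    I? : ∀ P l → Dec (P I l)
    join : ∀ P Q → P ≢ Q →
      ∃[ l ] (P I l × Q I l × (∀ m → P I m → Q I m → m ≡ l))
    playfair : ∀ P l →
      ∃[ m ] (P I m × (m ≡ l ⊎ (∀ R → ¬ (R I m × R I l)))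
             × (∀ m' → P I m' → (m' ≡ l ⊎ (∀ R → ¬ (R I m' × R I l))) → m' ≡ m))
    nondeg : Σ (Fin nP) λ P → Σ (Fin nP) λ Q → Σ (Fin nP) λ R →
      ¬ (∃[ l ] (P I l × Q I l × R I l))
    order : ∀ l → length (filter (λ P → I? P l) (allFinL nP)) ≡ q

module _ {q : ℕ} (Π : AffinePlane q) where
  open AffinePlane Π

  Vertex : Set
  Vertex = Fin nP ⊎ Fin nL

  Adj : Vertex → Vertex → Set
  Adj (inj₁ P) (inj₂ l) = P I l
  Adj (inj₂ l) (inj₁ P) = P I l
  Adj (inj₁ _) (inj₁ _) = ⊥
  Adj (inj₂ _) (inj₂ _) = ⊥

  data Walk : ℕ → Vertex → Vertex → Set where
    here : ∀ {v} → Walk zero v v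
    step : ∀ {n u w v} → Adj u w → Walk n w v → Walk (suc n) u v

  Dist : Vertex → Vertex → ℕ → Set
  Dist u v k = Walk k u v × (∀ m → Walk m u v → k Data.Nat.≤ m)

  _∥_ : Fin nL → Fin nL → Set
  l ∥ m = l ≡ m ⊎ (∀ R → ¬ (R I l × R I m))

  module _ (PS : Subset nP) (LS : Subset nL) where

    InS : Vertex → Set
    InS (inj₁ P) = P ∈ PS
    InS (inj₂ l) = l ∈ LS

    Resolving : Set
    Resolving = ∀ u v → u ≢ v → ∃[ x ] (InS x × ∃[ k ]
      ((Dist u x k × ¬ Dist v x k) ⊎ (Dist v x k × ¬ Dist u x k)))

    Uncovered : Fin nP → Set
    Uncovered P = ∀ l → l ∈ LS → ¬ (P I l)

    OneCovered : Fin nP → Set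
    OneCovered P = ∃[ l ] (l ∈ LS × P I l × (∀ m → m ∈ LS → P I m → m ≡ l))

    Skew : Fin nL → Set
    Skew l = ∀ P → P ∈ PS → ¬ (P I l)

    Tangent : Fin nL → Set
    Tangent l = ∃[ P ] (P ∈ PS × P I l × (∀ Q → Q ∈ PS → Q I l → Q ≡ P))

    -- the direction (parallel class) of l is covered
    DirCovered : Fin nL → Set
    DirCovered l = ∃[ m ] (m ∈ LS × m ∥ l)

    A1 : Set
    A1 = ∀ P Q → P ∉ PS → Q ∉ PS → Uncovered P → Uncovered Q → P ≡ Q

    A2 : Set
    A2 = ∀ l → l ∈ LS → ∀ P Q → P ∉ PS → Q ∉ PS →
      P I l → Q I l → OneCovered P → OneCovered Q → P ≡ Q

    A1' : Set
    A1' = (∀ l m → l ∉ LS → m ∉ LS → Skew l → Skew m →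
             DirCovered l → l ∥ m → l ≡ m)
        × (∀ l m → l ∉ LS → m ∉ LS → Skew l → Skew m →
             ¬ DirCovered l → ¬ DirCovered m → l ≡ m)

    A2' : Set
    A2' = ∀ P → P ∈ PS → ∀ l m → P I l → P I m → Tangent l → Tangent m →
      ¬ DirCovered l → ¬ DirCovered m → l ≡ m

-- Distances in the incidence graph of an affine plane take only the values
-- 0, 2 (two points), 1, 3 (incident / non-incident point and line) and
-- 0, 2, 4 (equal, meeting, parallel lines). Hence an outer point and an outer
-- line are resolved by parity as soon as S is nonempty (which (A1) forces in a
-- plane with three non-collinear points), two outer points are resolved exactly
-- when some inner line contains one of them but not the other, and two outer
-- lines exactly when some inner point lies on one but not the other or some
-- inner line is parallel to one but not the other. The conditions
-- (A1), (A2), (A1'), (A2') list precisely the pairs that escape this.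
module Submission where

open import Defs renaming (_∥_ to Parallel)
open import Data.Bool using (Bool; true; false; not)
open import Data.Bool.Properties using (not-injective)
open import Data.Empty using (⊥-elim)
open import Data.Fin using (Fin) renaming (_≟_ to _≟ᶠ_)
open import Data.Fin.Properties using (any?)
open import Data.Fin.Subset using (Subset; _∈_; _∉_)
open import Data.Fin.Subset.Properties using (_∈?_)
open import Data.Nat using (ℕ; zero; suc; _≤_; z≤n; s≤s) renaming (_≟_ to _≟ⁿ_)
open import Data.Nat.Properties using (≤-antisym)
open import Data.Product using (∃; _×_; _,_; proj₁; proj₂)
open import Data.Sum using (_⊎_; inj₁; inj₂)
open import Data.Sum.Properties using (inj₁-injective; inj₂-injective) renaming (≡-dec to ⊎-≡-dec)
open import Function using (case_of_)
open import Function.Bundles using (_⇔_; mk⇔; Equivalence)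
open import Function.Properties.Equivalence using () renaming (trans to ⇔-trans)
open import Relation.Nullary using (¬_; Dec; yes; no; contradiction)
open import Relation.Nullary.Decidable using (_×-dec_; _⊎-dec_; ¬?; map′; decidable-stable)
open import Relation.Binary.PropositionalEquality
  using (_≡_; _≢_; refl; sym; trans; cong; subst; module ≡-Reasoning)

open Equivalence using (to; from)

∉-∈-distinct : ∀ {n} {A : Subset n} {x y} → x ∉ A → y ∈ A → x ≢ y
∉-∈-distinct x∉A y∈A refl = x∉A y∈A

module AffineGeometry {q : ℕ} (Π : AffinePlane q) where
  open AffinePlane Π

  _∥_ : Fin nL → Fin nL → Set
  _∥_ = Parallel Π

  -- An empty line would be parallel to every line, so the parallels to it
  -- through a fixed point would contain all points.
  line-nonempty : ∀ l → ∃ λ P → P I l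
  line-nonempty l with any? (λ P → I? P l)
  ... | yes P∈l = P∈l
  ... | no l-empty with nondeg
  ...   | P , Q , R , noncollinear =
          ⊥-elim (noncollinear (parallel P , on-parallel P , on-parallel Q , on-parallel R))
    where
    parallel : Fin nP → Fin nL
    parallel X = proj₁ (playfair X l)

    parallel-unique : ∀ X m → X I m → m ≡ parallel X
    parallel-unique X m Xm =
      proj₂ (proj₂ (proj₂ (playfair X l))) m Xm (inj₂ λ R R∈m×l → l-empty (R , proj₂ R∈m×l))

    on-parallel : ∀ Y → Y I parallel P
    on-parallel Y with P ≟ᶠ Y
    ... | yes refl = proj₁ (proj₂ (playfair P l))
    ... | no P≢Y with join P Y P≢Y
    ...   | m , Pm , Ym , _ = subst (Y I_) (parallel-unique P m Pm) Ym

  ∥-sym : ∀ {l m} → l ∥ m → m ∥ l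
  ∥-sym (inj₁ refl) = inj₁ refl
  ∥-sym (inj₂ disjoint) = inj₂ λ R (Rm , Rl) → disjoint R (Rl , Rm)

  meet? : ∀ l m → Dec (∃ λ R → R I l × R I m)
  meet? l m = any? (λ R → I? R l ×-dec I? R m)

  ∥-trans : ∀ {l m n} → l ∥ m → m ∥ n → l ∥ n
  ∥-trans {l} {m} {n} l∥m m∥n with meet? l n
  ... | no l∩n=∅ = inj₂ λ R R∈l×n → l∩n=∅ (R , R∈l×n)
  ... | yes (X , Xl , Xn) with playfair X m
  ...   | _ , _ , _ , unique = inj₁ (trans (unique l Xl l∥m) (sym (unique n Xn (∥-sym m∥n))))

  ∥? : ∀ l m → Dec (l ∥ m)
  ∥? l m with l ≟ᶠ m | meet? l m
  ... | yes l≡m | _ = yes (inj₁ l≡m)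
  ... | no l≢m | yes (R , Rl , Rm) =
        no λ { (inj₁ l≡m) → l≢m l≡m ; (inj₂ disjoint) → disjoint R (Rl , Rm) }
  ... | no _ | no l∩m=∅ = yes (inj₂ λ R R∈l×m → l∩m=∅ (R , R∈l×m))

  ¬∥⇒meet : ∀ {l m} → ¬ l ∥ m → ∃ λ R → R I l × R I m
  ¬∥⇒meet {l} {m} l∦m with meet? l m
  ... | yes meeting = meeting
  ... | no l∩m=∅ = contradiction (inj₂ λ R R∈l×m → l∩m=∅ (R , R∈l×m)) l∦m

  meet-unique : ∀ {l m R X} → l ≢ m → R I l → R I m → X I l → X I m → R ≡ X
  meet-unique {l} {m} {R} {X} l≢m Rl Rm Xl Xm with R ≟ᶠ X
  ... | yes R≡X = R≡X
  ... | no R≢X with join R X R≢X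
  ...   | _ , _ , _ , unique = contradiction (trans (unique l Rl Xl) (sym (unique m Rm Xm))) l≢m

module IncidenceGraph {q : ℕ} (Π : AffinePlane q) where
  open AffinePlane Π
  open AffineGeometry Π

  private
    V : Set
    V = Vertex Π

  isPoint : V → Bool
  isPoint (inj₁ _) = true
  isPoint (inj₂ _) = false

  flips : ℕ → Bool → Bool
  flips zero b = b
  flips (suc n) b = flips n (not b)

  flips-injective : ∀ n {b c} → flips n b ≡ flips n c → b ≡ c
  flips-injective zero b≡c = b≡c
  flips-injective (suc n) e = not-injective (flips-injective n e)

  Adj-flips : ∀ {u w} → Adj Π u w → isPoint w ≡ not (isPoint u)
  Adj-flips {inj₁ _} {inj₂ _} _ = refl
  Adj-flips {inj₂ _} {inj₁ _} _ = refl

  Adj-sym : ∀ {u w} → Adj Π u w → Adj Π w u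
  Adj-sym {inj₁ _} {inj₂ _} P∈l = P∈l
  Adj-sym {inj₂ _} {inj₁ _} P∈l = P∈l

  walk-parity : ∀ {n u v} → Walk Π n u v → flips n (isPoint u) ≡ isPoint v
  walk-parity here = refl
  walk-parity {suc n} (step a w) = trans (cong (flips n) (sym (Adj-flips a))) (walk-parity w)

  walks-same-length⇒same-side : ∀ {k u v x} → Walk Π k u x → Walk Π k v x → isPoint u ≡ isPoint v
  walks-same-length⇒same-side {k} w w′ = flips-injective k (trans (walk-parity w) (sym (walk-parity w′)))

  walk-snoc : ∀ {n u w v} → Walk Π n u w → Adj Π w v → Walk Π (suc n) u v
  walk-snoc here a = step a here
  walk-snoc (step b w) a = step b (walk-snoc w a)

  walk-reverse : ∀ {n u v} → Walk Π n u v → Walk Π n v u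
  walk-reverse here = here
  walk-reverse (step {u = u} {w = w} a walk) = walk-snoc (walk-reverse walk) (Adj-sym {u} {w} a)

  walk-length-0 : ∀ {u v} → Walk Π 0 u v → u ≡ v
  walk-length-0 here = refl

  walk-length-1 : ∀ {P l} → Walk Π 1 (inj₁ P) (inj₂ l) → P I l
  walk-length-1 (step P∈l here) = P∈l

  walk-length-2 : ∀ {l m} → Walk Π 2 (inj₂ l) (inj₂ m) → ∃ λ R → R I l × R I m
  walk-length-2 (step {w = inj₁ R} Rl (step Rm here)) = R , Rl , Rm

  Dist-sym : ∀ {u v k} → Dist Π u v k → Dist Π v u k
  Dist-sym (walk , shortest) = walk-reverse walk , λ n w → shortest n (walk-reverse w)

  Dist-unique : ∀ {u v k k′} → Dist Π u v k → Dist Π u v k′ → k ≡ k′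
  Dist-unique (w , shortest) (w′ , shortest′) = ≤-antisym (shortest _ w′) (shortest′ _ w)

  Dist-refl : ∀ u → Dist Π u u 0
  Dist-refl u = here , λ _ _ → z≤n

  Dist-points : ∀ {P Q} → P ≢ Q → Dist Π (inj₁ P) (inj₁ Q) 2
  Dist-points {P} {Q} P≢Q with join P Q P≢Q
  ... | l , Pl , Ql , _ = step {w = inj₂ l} Pl (step {w = inj₁ Q} Ql here) , shortest
    where
    shortest : ∀ n → Walk Π n (inj₁ P) (inj₁ Q) → 2 ≤ n
    shortest 0 w = contradiction (inj₁-injective (walk-length-0 w)) P≢Q
    shortest 1 w = contradiction (walk-parity w) λ ()
    shortest (suc (suc _)) _ = s≤s (s≤s z≤n)

  Dist-incident : ∀ {P l} → P I l → Dist Π (inj₁ P) (inj₂ l) 1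
  Dist-incident {P} {l} Pl = step {w = inj₂ l} Pl here , shortest
    where
    shortest : ∀ n → Walk Π n (inj₁ P) (inj₂ l) → 1 ≤ n
    shortest 0 w = contradiction (walk-length-0 w) λ ()
    shortest (suc _) _ = s≤s z≤n

  Dist-nonincident : ∀ {P l} → ¬ P I l → Dist Π (inj₁ P) (inj₂ l) 3
  Dist-nonincident {P} {l} P∉l with line-nonempty l
  ... | Q , Ql with join P Q (λ { refl → P∉l Ql })
  ...   | m , Pm , Qm , _ =
          step {w = inj₂ m} Pm (step {w = inj₁ Q} Qm (step {w = inj₂ l} Ql here)) , shortest
    where
    shortest : ∀ n → Walk Π n (inj₁ P) (inj₂ l) → 3 ≤ n
    shortest 0 w = contradiction (walk-length-0 w) λ ()
    shortest 1 w = contradiction (walk-length-1 w) P∉l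
    shortest 2 w = contradiction (walk-parity w) λ ()
    shortest (suc (suc (suc _))) _ = s≤s (s≤s (s≤s z≤n))

  Dist-meeting : ∀ {l m} → ¬ l ∥ m → Dist Π (inj₂ l) (inj₂ m) 2
  Dist-meeting {l} {m} l∦m with ¬∥⇒meet l∦m
  ... | R , Rl , Rm = step {w = inj₁ R} Rl (step {w = inj₂ m} Rm here) , shortest
    where
    shortest : ∀ n → Walk Π n (inj₂ l) (inj₂ m) → 2 ≤ n
    shortest 0 w = contradiction (inj₁ (inj₂-injective (walk-length-0 w))) l∦m
    shortest 1 w = contradiction (walk-parity w) λ ()
    shortest (suc (suc _)) _ = s≤s (s≤s z≤n)

  Dist-parallel : ∀ {l m} → l ≢ m → l ∥ m → Dist Π (inj₂ l) (inj₂ m) 4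
  Dist-parallel l≢m (inj₁ l≡m) = contradiction l≡m l≢m
  Dist-parallel {l} {m} l≢m (inj₂ disjoint) with line-nonempty l | line-nonempty m
  ... | P , Pl | Q , Qm with join P Q (λ { refl → disjoint P (Pl , Qm) })
  ...   | n , Pn , Qn , _ =
          step {w = inj₁ P} Pl (step {w = inj₂ n} Pn (step {w = inj₁ Q} Qn (step {w = inj₂ m} Qm here)))
          , shortest
    where
    shortest : ∀ k → Walk Π k (inj₂ l) (inj₂ m) → 4 ≤ k
    shortest 0 w = contradiction (inj₂-injective (walk-length-0 w)) l≢m
    shortest 1 w = contradiction (walk-parity w) λ ()
    shortest 2 w with walk-length-2 w
    ... | R , Rl , Rm = contradiction (Rl , Rm) (disjoint R)
    shortest 3 w = contradiction (walk-parity w) λ ()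
    shortest (suc (suc (suc (suc _)))) _ = s≤s (s≤s (s≤s (s≤s z≤n)))

  distance : ∀ u v → ∃ (Dist Π u v)
  distance (inj₁ P) (inj₁ Q) with P ≟ᶠ Q
  ... | yes refl = 0 , Dist-refl _
  ... | no P≢Q = 2 , Dist-points P≢Q
  distance (inj₁ P) (inj₂ l) with I? P l
  ... | yes Pl = 1 , Dist-incident Pl
  ... | no P∉l = 3 , Dist-nonincident P∉l
  distance (inj₂ l) (inj₁ P) with distance (inj₁ P) (inj₂ l)
  ... | k , d = k , Dist-sym d
  distance (inj₂ l) (inj₂ m) with l ≟ᶠ m | ∥? l m
  ... | yes refl | _ = 0 , Dist-refl _
  ... | no l≢m | yes l∥m = 4 , Dist-parallel l≢m l∥m
  ... | no _ | no l∦m = 2 , Dist-meeting l∦m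

  dist : V → V → ℕ
  dist u v = proj₁ (distance u v)

  dist-correct : ∀ u v → Dist Π u v (dist u v)
  dist-correct u v = proj₂ (distance u v)

  Dist⇒dist : ∀ {u v k} → Dist Π u v k → dist u v ≡ k
  Dist⇒dist = Dist-unique (dist-correct _ _)

  dist-sym : ∀ u v → dist u v ≡ dist v u
  dist-sym u v = Dist⇒dist (Dist-sym (dist-correct v u))

  dist≡0⇒≡ : ∀ {u v} → dist u v ≡ 0 → u ≡ v
  dist≡0⇒≡ {u} {v} e = walk-length-0 (proj₁ (subst (Dist Π u v) e (dist-correct u v)))

  dist≡1⇒incident : ∀ {P l} → dist (inj₁ P) (inj₂ l) ≡ 1 → P I l
  dist≡1⇒incident {P} {l} e =
    decidable-stable (I? P l) λ P∉l → contradiction (trans (sym e) (Dist⇒dist (Dist-nonincident P∉l))) λ ()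

  dist≡4⇒∥ : ∀ {l m} → dist (inj₂ l) (inj₂ m) ≡ 4 → l ∥ m
  dist≡4⇒∥ {l} {m} e =
    decidable-stable (∥? l m) λ l∦m → contradiction (trans (sym e) (Dist⇒dist (Dist-meeting l∦m))) λ ()

  equal-dist⇒same-side : ∀ {u v x} → dist u x ≡ dist v x → isPoint u ≡ isPoint v
  equal-dist⇒same-side {u} {v} {x} e =
    walks-same-length⇒same-side (proj₁ (dist-correct u x))
                                (proj₁ (subst (Dist Π v x) (sym e) (dist-correct v x)))

module ResolvingSets {q : ℕ} (Π : AffinePlane q)
  (PS : Subset (AffinePlane.nP Π)) (LS : Subset (AffinePlane.nL Π)) where
  open AffinePlane Π
  open AffineGeometry Π
  open IncidenceGraph Π

  private
    V : Set
    V = Vertex Π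

    Inner : V → Set
    Inner = InS Π PS LS

  any-inner? : {R : V → Set} → (∀ x → Dec (R x)) → Dec (∃ λ x → Inner x × R x)
  any-inner? {R} R? = map′ fromSum toSum
    (any? (λ P → P ∈? PS ×-dec R? (inj₁ P)) ⊎-dec any? (λ l → l ∈? LS ×-dec R? (inj₂ l)))
    where
    InnerPointOrLine : Set
    InnerPointOrLine = (∃ λ P → P ∈ PS × R (inj₁ P)) ⊎ (∃ λ l → l ∈ LS × R (inj₂ l))
    fromSum : InnerPointOrLine → ∃ λ x → Inner x × R x
    fromSum (inj₁ (P , inner)) = inj₁ P , inner
    fromSum (inj₂ (l , inner)) = inj₂ l , inner
    toSum : (∃ λ x → Inner x × R x) → InnerPointOrLine
    toSum (inj₁ P , inner) = inj₁ (P , inner)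
    toSum (inj₂ l , inner) = inj₂ (l , inner)

  Equidistant : V → V → Set
  Equidistant u v = ∀ x → Inner x → dist u x ≡ dist v x

  Equidistant-sym : ∀ {u v} → Equidistant u v → Equidistant v u
  Equidistant-sym eq x inner = sym (eq x inner)

  resolving⇔equidistant⇒≡ : Resolving Π PS LS ⇔ (∀ u v → Equidistant u v → u ≡ v)
  resolving⇔equidistant⇒≡ = mk⇔ equidistant⇒≡ resolving
    where
    transport : ∀ {u v x k} → dist u x ≡ dist v x → Dist Π u x k → Dist Π v x k
    transport {v = v} {x} e d = subst (Dist Π v x) (trans (sym e) (Dist⇒dist d)) (dist-correct v x)

    equidistant⇒≡ : Resolving Π PS LS → ∀ u v → Equidistant u v → u ≡ v
    equidistant⇒≡ res u v eq with ⊎-≡-dec _≟ᶠ_ _≟ᶠ_ u v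
    ... | yes u≡v = u≡v
    ... | no u≢v with res u v u≢v
    ...   | x , inner , _ , inj₁ (du , ¬dv) = contradiction (transport (eq x inner) du) ¬dv
    ...   | x , inner , _ , inj₂ (dv , ¬du) = contradiction (transport (sym (eq x inner)) dv) ¬du

    resolving : (∀ u v → Equidistant u v → u ≡ v) → Resolving Π PS LS
    resolving rigid u v u≢v with any-inner? (λ x → ¬? (dist u x ≟ⁿ dist v x))
    ... | yes (x , inner , different) =
          x , inner , dist u x , inj₁ (dist-correct u x , λ dv → different (sym (Dist⇒dist dv)))
    ... | no none = contradiction (rigid u v λ x inner →
                      decidable-stable (dist u x ≟ⁿ dist v x) λ different → none (x , inner , different)) u≢v

  outer-inner-points-dist : ∀ {P R} → P ∉ PS → R ∈ PS → dist (inj₁ P) (inj₁ R) ≡ 2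
  outer-inner-points-dist P∉S R∈S = Dist⇒dist (Dist-points (∉-∈-distinct P∉S R∈S))

  skew-inner-point-dist : ∀ {l R} → Skew Π PS LS l → R ∈ PS → dist (inj₂ l) (inj₁ R) ≡ 3
  skew-inner-point-dist skew R∈S = Dist⇒dist (Dist-sym (Dist-nonincident (skew _ R∈S)))

  uncovered-direction-inner-line-dist : ∀ {l n} → ¬ DirCovered Π PS LS l → n ∈ LS →
    dist (inj₂ l) (inj₂ n) ≡ 2
  uncovered-direction-inner-line-dist ¬covered n∈S =
    Dist⇒dist (Dist-meeting λ l∥n → ¬covered (_ , n∈S , ∥-sym l∥n))

  OneCovered-unique : ∀ {P l n} → OneCovered Π PS LS P → n ∈ LS → P I n → l ∈ LS → P I l → n ≡ l
  OneCovered-unique (_ , _ , _ , unique) n∈S Pn l∈S Pl = trans (unique _ n∈S Pn) (sym (unique _ l∈S Pl))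

  Tangent-unique : ∀ {l P R} → Tangent Π PS LS l → R ∈ PS → R I l → P ∈ PS → P I l → R ≡ P
  Tangent-unique (_ , _ , _ , unique) R∈S Rl P∈S Pl = trans (unique _ R∈S Rl) (sym (unique _ P∈S Pl))

  uncovered-outer-points-equidistant : ∀ {P Q} → P ∉ PS → Q ∉ PS →
    Uncovered Π PS LS P → Uncovered Π PS LS Q → Equidistant (inj₁ P) (inj₁ Q)
  uncovered-outer-points-equidistant P∉S Q∉S _ _ (inj₁ R) R∈S =
    trans (outer-inner-points-dist P∉S R∈S) (sym (outer-inner-points-dist Q∉S R∈S))
  uncovered-outer-points-equidistant _ _ P-uncovered Q-uncovered (inj₂ n) n∈S =
    trans (Dist⇒dist (Dist-nonincident (P-uncovered n n∈S)))
          (sym (Dist⇒dist (Dist-nonincident (Q-uncovered n n∈S))))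

  one-covered-outer-points-equidistant : ∀ {l P Q} → l ∈ LS → P ∉ PS → Q ∉ PS → P I l → Q I l →
    OneCovered Π PS LS P → OneCovered Π PS LS Q → Equidistant (inj₁ P) (inj₁ Q)
  one-covered-outer-points-equidistant _ P∉S Q∉S _ _ _ _ (inj₁ R) R∈S =
    trans (outer-inner-points-dist P∉S R∈S) (sym (outer-inner-points-dist Q∉S R∈S))
  one-covered-outer-points-equidistant {l} l∈S _ _ Pl Ql P-one Q-one (inj₂ n) n∈S with n ≟ᶠ l
  ... | yes refl = trans (Dist⇒dist (Dist-incident Pl)) (sym (Dist⇒dist (Dist-incident Ql)))
  ... | no n≢l =
        trans (Dist⇒dist (Dist-nonincident λ Pn → n≢l (OneCovered-unique P-one n∈S Pn l∈S Pl)))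
              (sym (Dist⇒dist (Dist-nonincident λ Qn → n≢l (OneCovered-unique Q-one n∈S Qn l∈S Ql))))

  skew-outer-parallel-lines-equidistant : ∀ {l m} → l ∉ LS → m ∉ LS →
    Skew Π PS LS l → Skew Π PS LS m → l ∥ m → Equidistant (inj₂ l) (inj₂ m)
  skew-outer-parallel-lines-equidistant _ _ l-skew m-skew _ (inj₁ R) R∈S =
    trans (skew-inner-point-dist l-skew R∈S) (sym (skew-inner-point-dist m-skew R∈S))
  -- `case` rather than `with`: `dist` itself is computed by `∥? l n`, which `with` would abstract.
  skew-outer-parallel-lines-equidistant {l} l∉S m∉S _ _ l∥m (inj₂ n) n∈S = case ∥? l n of λ where
    (yes l∥n) →
        trans (Dist⇒dist (Dist-parallel (∉-∈-distinct l∉S n∈S) l∥n))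
              (sym (Dist⇒dist (Dist-parallel (∉-∈-distinct m∉S n∈S) (∥-trans (∥-sym l∥m) l∥n))))
    (no l∦n) →
        trans (Dist⇒dist (Dist-meeting l∦n))
              (sym (Dist⇒dist (Dist-meeting λ m∥n → l∦n (∥-trans l∥m m∥n))))

  skew-uncovered-direction-lines-equidistant : ∀ {l m} → Skew Π PS LS l → Skew Π PS LS m →
    ¬ DirCovered Π PS LS l → ¬ DirCovered Π PS LS m → Equidistant (inj₂ l) (inj₂ m)
  skew-uncovered-direction-lines-equidistant l-skew m-skew _ _ (inj₁ R) R∈S =
    trans (skew-inner-point-dist l-skew R∈S) (sym (skew-inner-point-dist m-skew R∈S))
  skew-uncovered-direction-lines-equidistant _ _ l-uncovered m-uncovered (inj₂ n) n∈S =
    trans (uncovered-direction-inner-line-dist l-uncovered n∈S)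
          (sym (uncovered-direction-inner-line-dist m-uncovered n∈S))

  tangent-uncovered-direction-lines-equidistant : ∀ {P l m} → P ∈ PS → P I l → P I m →
    Tangent Π PS LS l → Tangent Π PS LS m →
    ¬ DirCovered Π PS LS l → ¬ DirCovered Π PS LS m → Equidistant (inj₂ l) (inj₂ m)
  tangent-uncovered-direction-lines-equidistant {P} P∈S Pl Pm l-tangent m-tangent _ _ (inj₁ R) R∈S
    with R ≟ᶠ P
  ... | yes refl =
        trans (Dist⇒dist (Dist-sym (Dist-incident Pl))) (sym (Dist⇒dist (Dist-sym (Dist-incident Pm))))
  ... | no R≢P =
        trans (Dist⇒dist (Dist-sym (Dist-nonincident λ Rl → R≢P (Tangent-unique l-tangent R∈S Rl P∈S Pl))))
              (sym (Dist⇒dist (Dist-sym (Dist-nonincident λ Rm → R≢P (Tangent-unique m-tangent R∈S Rm P∈S Pm)))))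
  tangent-uncovered-direction-lines-equidistant _ _ _ _ _ l-uncovered m-uncovered (inj₂ n) n∈S =
    trans (uncovered-direction-inner-line-dist l-uncovered n∈S)
          (sym (uncovered-direction-inner-line-dist m-uncovered n∈S))

  equidistant⇒≡-conditions : (∀ u v → Equidistant u v → u ≡ v) →
    A1 Π PS LS × A2 Π PS LS × A1' Π PS LS × A2' Π PS LS
  equidistant⇒≡-conditions rigid =
      (λ P Q P∉S Q∉S P-unc Q-unc →
         inj₁-injective (rigid _ _ (uncovered-outer-points-equidistant P∉S Q∉S P-unc Q-unc)))
    , (λ l l∈S P Q P∉S Q∉S Pl Ql P-one Q-one →
         inj₁-injective (rigid _ _ (one-covered-outer-points-equidistant l∈S P∉S Q∉S Pl Ql P-one Q-one)))
    , ( (λ l m l∉S m∉S l-skew m-skew _ l∥m →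
           inj₂-injective (rigid _ _ (skew-outer-parallel-lines-equidistant l∉S m∉S l-skew m-skew l∥m)))
      , (λ l m _ _ l-skew m-skew l-unc m-unc →
           inj₂-injective (rigid _ _ (skew-uncovered-direction-lines-equidistant l-skew m-skew l-unc m-unc))))
    , (λ P P∈S l m Pl Pm l-tan m-tan l-unc m-unc →
         inj₂-injective (rigid _ _
           (tangent-uncovered-direction-lines-equidistant P∈S Pl Pm l-tan m-tan l-unc m-unc)))

  SameInnerLines : Fin nP → Fin nP → Set
  SameInnerLines P Q = ∀ n → n ∈ LS → (P I n ⇔ Q I n)

  SameInnerPoints : Fin nL → Fin nL → Set
  SameInnerPoints l m = ∀ R → R ∈ PS → (R I l ⇔ R I m)

  SameInnerDirections : Fin nL → Fin nL → Set
  SameInnerDirections l m = ∀ n → n ∈ LS → (l ∥ n ⇔ m ∥ n)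

  equidistant-points-same-inner-lines : ∀ {P Q} → Equidistant (inj₁ P) (inj₁ Q) → SameInnerLines P Q
  equidistant-points-same-inner-lines {P} {Q} eq n n∈S =
    mk⇔ (shared eq) (shared (Equidistant-sym {inj₁ P} {inj₁ Q} eq))
    where
    shared : ∀ {P Q} → Equidistant (inj₁ P) (inj₁ Q) → P I n → Q I n
    shared eq Pn = dist≡1⇒incident (trans (sym (eq (inj₂ n) n∈S)) (Dist⇒dist (Dist-incident Pn)))

  equidistant-lines-same-inner-points : ∀ {l m} → Equidistant (inj₂ l) (inj₂ m) → SameInnerPoints l m
  equidistant-lines-same-inner-points {l} {m} eq R R∈S =
    mk⇔ (shared eq) (shared (Equidistant-sym {inj₂ l} {inj₂ m} eq))
    where
    open ≡-Reasoning
    shared : ∀ {l m} → Equidistant (inj₂ l) (inj₂ m) → R I l → R I m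
    shared {l} {m} eq Rl = dist≡1⇒incident (begin
      dist (inj₁ R) (inj₂ m) ≡⟨ dist-sym (inj₁ R) (inj₂ m) ⟩
      dist (inj₂ m) (inj₁ R) ≡⟨ sym (eq (inj₁ R) R∈S) ⟩
      dist (inj₂ l) (inj₁ R) ≡⟨ dist-sym (inj₂ l) (inj₁ R) ⟩
      dist (inj₁ R) (inj₂ l) ≡⟨ Dist⇒dist (Dist-incident Rl) ⟩
      1                      ∎)

  equidistant-outer-lines-same-inner-directions : ∀ {l m} → l ∉ LS → m ∉ LS →
    Equidistant (inj₂ l) (inj₂ m) → SameInnerDirections l m
  equidistant-outer-lines-same-inner-directions {l} {m} l∉S m∉S eq n n∈S =
    mk⇔ (shared l∉S eq) (shared m∉S (Equidistant-sym {inj₂ l} {inj₂ m} eq))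
    where
    shared : ∀ {l m} → l ∉ LS → Equidistant (inj₂ l) (inj₂ m) → l ∥ n → m ∥ n
    shared l∉S eq l∥n =
      dist≡4⇒∥ (trans (sym (eq (inj₂ n) n∈S)) (Dist⇒dist (Dist-parallel (∉-∈-distinct l∉S n∈S) l∥n)))

  outer-points-rigid : A1 Π PS LS → A2 Π PS LS →
    ∀ {P Q} → P ∉ PS → Q ∉ PS → SameInnerLines P Q → P ≡ Q
  outer-points-rigid a1 a2 {P} {Q} P∉S Q∉S same with P ≟ᶠ Q | any? (λ n → n ∈? LS ×-dec I? P n)
  ... | yes P≡Q | _ = P≡Q
  ... | no _ | no P-uncovered =
        a1 P Q P∉S Q∉S (λ n n∈S Pn → P-uncovered (n , n∈S , Pn))
                       (λ n n∈S Qn → P-uncovered (n , n∈S , from (same n n∈S) Qn))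
  ... | no P≢Q | yes (n , n∈S , Pn) with join P Q P≢Q
  ...   | _ , _ , _ , unique =
          a2 n n∈S P Q P∉S Q∉S Pn (to (same n n∈S) Pn)
             (n , n∈S , Pn , λ m m∈S Pm → only-n m (Pm , to (same m m∈S) Pm))
             (n , n∈S , to (same n n∈S) Pn , λ m m∈S Qm → only-n m (from (same m m∈S) Qm , Qm))
    where
    -- every inner line through P or Q contains both, so it is their join
    only-n : ∀ m → P I m × Q I m → m ≡ n
    only-n m (Pm , Qm) = trans (unique m Pm Qm) (sym (unique n Pn (to (same n n∈S) Pn)))

  dirCovered? : ∀ l → Dec (DirCovered Π PS LS l)
  dirCovered? l = any? (λ n → n ∈? LS ×-dec ∥? n l)

  module _ (a1' : A1' Π PS LS) (a2' : A2' Π PS LS) {l m : Fin nL} (l∉S : l ∉ LS) (m∉S : m ∉ LS)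
           (samePoints : SameInnerPoints l m) (sameDirections : SameInnerDirections l m) where

    disjoint⇒skew : (∀ R → ¬ (R I l × R I m)) → Skew Π PS LS l × Skew Π PS LS m
    disjoint⇒skew disjoint =
        (λ R R∈S Rl → disjoint R (Rl , to (samePoints R R∈S) Rl))
      , (λ R R∈S Rm → disjoint R (from (samePoints R R∈S) Rm , Rm))

    disjoint-outer-lines-rigid : (∀ R → ¬ (R I l × R I m)) → l ≡ m
    disjoint-outer-lines-rigid disjoint with dirCovered? l | disjoint⇒skew disjoint
    ... | yes covered | l-skew , m-skew = proj₁ a1' l m l∉S m∉S l-skew m-skew covered (inj₂ disjoint)
    ... | no l-uncovered | l-skew , m-skew = proj₂ a1' l m l∉S m∉S l-skew m-skew l-uncovered
          λ (n , n∈S , n∥m) → l-uncovered (n , n∈S , ∥-trans n∥m (∥-sym (inj₂ disjoint)))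

    module _ {X} (l≢m : l ≢ m) (Xl : X I l) (Xm : X I m) where

      inner-on-l⇒meet : ∀ {R} → R ∈ PS → R I l → R ≡ X
      inner-on-l⇒meet R∈S Rl = meet-unique l≢m Rl (to (samePoints _ R∈S) Rl) Xl Xm

      inner-on-m⇒meet : ∀ {R} → R ∈ PS → R I m → R ≡ X
      inner-on-m⇒meet R∈S Rm = meet-unique l≢m (from (samePoints _ R∈S) Rm) Rm Xl Xm

      meeting⇒uncovered-directions : ¬ DirCovered Π PS LS l × ¬ DirCovered Π PS LS m
      meeting⇒uncovered-directions =
          (λ (n , n∈S , n∥l) → l∦m (∥-trans (∥-sym n∥l) (∥-sym (to (sameDirections n n∈S) (∥-sym n∥l)))))
        , (λ (n , n∈S , n∥m) → l∦m (∥-trans (from (sameDirections n n∈S) (∥-sym n∥m)) n∥m))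
        where
        l∦m : ¬ l ∥ m
        l∦m (inj₁ l≡m) = l≢m l≡m
        l∦m (inj₂ disjoint) = disjoint X (Xl , Xm)

    meeting-outer-lines-rigid : ∀ {X} → X I l → X I m → l ≡ m
    meeting-outer-lines-rigid {X} Xl Xm with l ≟ᶠ m
    ... | yes l≡m = l≡m
    ... | no l≢m with X ∈? PS | meeting⇒uncovered-directions l≢m Xl Xm
    ...   | yes X∈S | l-uncovered , m-uncovered =
            a2' X X∈S l m Xl Xm
                (X , X∈S , Xl , λ _ R∈S Rl → inner-on-l⇒meet l≢m Xl Xm R∈S Rl)
                (X , X∈S , Xm , λ _ R∈S Rm → inner-on-m⇒meet l≢m Xl Xm R∈S Rm)
                l-uncovered m-uncovered
    ...   | no X∉S | l-uncovered , m-uncovered =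
            proj₂ a1' l m l∉S m∉S
                  (λ _ R∈S Rl → X∉S (subst (_∈ PS) (inner-on-l⇒meet l≢m Xl Xm R∈S Rl) R∈S))
                  (λ _ R∈S Rm → X∉S (subst (_∈ PS) (inner-on-m⇒meet l≢m Xl Xm R∈S Rm) R∈S))
                  l-uncovered m-uncovered

    outer-lines-rigid : l ≡ m
    outer-lines-rigid with ∥? l m
    ... | yes (inj₁ l≡m) = l≡m
    ... | yes (inj₂ disjoint) = disjoint-outer-lines-rigid disjoint
    ... | no l∦m with ¬∥⇒meet l∦m
    ...   | _ , Xl , Xm = meeting-outer-lines-rigid Xl Xm

  inner? : ∀ x → Dec (Inner x)
  inner? (inj₁ P) = P ∈? PS
  inner? (inj₂ l) = l ∈? LS

  inner-vertex : A1 Π PS LS → Fin nL → ∃ Inner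
  inner-vertex a1 l with any-inner? inner?
  ... | yes (x , x∈S , _) = x , x∈S
  ... | no S-empty with nondeg | line-nonempty l
  ...   | P , Q , R , noncollinear | X , Xl =
          ⊥-elim (noncollinear (l , on-l P , on-l Q , on-l R))
    where
    -- with S empty every point is an uncovered outer point, so (A1) leaves only one point
    on-l : ∀ Y → Y I l
    on-l Y = subst (_I l) (a1 X Y (outer X) (outer Y) (uncovered X) (uncovered Y)) Xl
      where
      outer : ∀ Z → Z ∉ PS
      outer Z Z∈S = S-empty (inj₁ Z , Z∈S , Z∈S)
      uncovered : ∀ Z → Uncovered Π PS LS Z
      uncovered _ n n∈S _ = S-empty (inj₂ n , n∈S , n∈S)

  equidistant⇒same-side : A1 Π PS LS → Fin nL → ∀ {u v} → Equidistant u v → isPoint u ≡ isPoint v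
  equidistant⇒same-side a1 l {u} {v} eq with inner-vertex a1 l
  ... | x , x∈S = equal-dist⇒same-side {u} {v} (eq x x∈S)

  conditions⇒equidistant⇒≡ : A1 Π PS LS × A2 Π PS LS × A1' Π PS LS × A2' Π PS LS →
    ∀ u v → Equidistant u v → u ≡ v
  conditions⇒equidistant⇒≡ (a1 , a2 , a1' , a2') u v eq with inner? u | inner? v
  ... | yes u∈S | _ = sym (dist≡0⇒≡ (trans (sym (eq u u∈S)) (Dist⇒dist (Dist-refl u))))
  ... | no _ | yes v∈S = dist≡0⇒≡ (trans (eq v v∈S) (Dist⇒dist (Dist-refl v)))
  conditions⇒equidistant⇒≡ (a1 , a2 , _ , _) (inj₁ _) (inj₁ _) eq | no P∉S | no Q∉S =
    cong inj₁ (outer-points-rigid a1 a2 P∉S Q∉S (equidistant-points-same-inner-lines eq))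
  conditions⇒equidistant⇒≡ (_ , _ , a1' , a2') (inj₂ _) (inj₂ _) eq | no l∉S | no m∉S =
    cong inj₂ (outer-lines-rigid a1' a2' l∉S m∉S (equidistant-lines-same-inner-points eq)
                                 (equidistant-outer-lines-same-inner-directions l∉S m∉S eq))
  conditions⇒equidistant⇒≡ (a1 , _) (inj₁ P) (inj₂ l) eq | no _ | no _ =
    contradiction (equidistant⇒same-side a1 l {inj₁ P} {inj₂ l} eq) λ ()
  conditions⇒equidistant⇒≡ (a1 , _) (inj₂ l) (inj₁ P) eq | no _ | no _ =
    contradiction (equidistant⇒same-side a1 l {inj₂ l} {inj₁ P} eq) λ ()

mainTheorem10 : ∀ {q : ℕ} (Π : AffinePlane q) →
    (PS : Subset (AffinePlane.nP Π)) (LS : Subset (AffinePlane.nL Π)) →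
    Resolving Π PS LS ⇔ (A1 Π PS LS × A2 Π PS LS × A1' Π PS LS × A2' Π PS LS)
mainTheorem10 Π PS LS =
  ⇔-trans resolving⇔equidistant⇒≡ (mk⇔ equidistant⇒≡-conditions conditions⇒equidistant⇒≡)
  where open ResolvingSets Π PS LS
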